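{- Let $\mathcal G$ be an arbitrary graph of groups and let $w=g_0y_1g_1\cdots y_ng_n\in\Pi(\mathcal G)$ with $n\ge1$ be Britton-reduced. If $\hat w$ is a Britton-reduced word with $$y_{\lfloor n/2+1\rfloor}g_{\lfloor n/2+1\rfloor}\cdots y_ng_ng_0y_1g_1\cdots y_{\lfloor n/2\rfloor}g_{\lfloor n/2\rfloor}\;\xrightarrow{*}_{B_{\mathcal G}}\;\hat w,$$ then $\hat w$ is cyclically Britton-reduced and $w$ is conjugate to $\hat w$ in $F(\mathcal G)$.
   Context: A graph of groups $\mathcal G$ over a connected graph $Y$ (Serre's sense: vertices $V(Y)$, edges $E(Y)$, maps $\iota,\tau$, fixed-point-free involution $y\mapsto\bar y$ with $\iota(y)=\tau(\bar y)$) consists of vertex groups $G_a$ ($a\in V(Y)$), edge groups $G_y=G_{\bar y}$ and injective homomorphisms $G_y\to G_{\iota(y)}$, $c\mapsto c^y$. Let $\Delta=E(Y)\cup\bigcup_{a\in V(Y)}(G_a\setminus\{1\})$ (disjoint union), identifying $1\in G_a$ with the empty word. $F(\mathcal G)$ is the quotient of the free monoid $\Delta^*$ by the relations $gh=[gh]$ ($g,h\in G_a$, $[gh]$ their product in $G_a$) and $y\,c^{\bar y}\,\bar y=c^y$ ($y\in E(Y)$, $c\in G_y$); it is a group. $\Pi(\mathcal G)$ is the set of words $g_0y_1g_1\cdots y_ng_n$ with $y_i\in E(Y)$, $\tau(y_i)=\iota(y_{i+1})$, $\tau(y_n)=\iota(y_1)$, $g_0\in G_{\iota(y_1)}$, $g_i\in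 G_{\tau(y_i)}$. The rewriting system $B_{\mathcal G}$ has rules $gh\to[gh]$ for $g,h\in G_a\setminus\{1\}$ and $y\,c^{\bar y}\,\bar y\to c^y$ for $y\in E(Y)$, $c\in G_y$; $\xrightarrow{*}_{B_{\mathcal G}}$ is its reflexive transitive closure. A word is Britton-reduced if no rule applies, and cyclically Britton-reduced if every cyclic permutation of it (word $u'u$ where the word is $uu'$) is Britton-reduced. -}

module Defs where

open import Level using (0ℓ)
open import Data.Nat using (ℕ; ⌊_/2⌋)
open import Data.Product using (Σ; _×_; _,_; proj₁; proj₂)
open import Data.List using (List; []; _∷_; _++_; [_]; map; concatMap; splitAt; length)
open import Data.List.NonEmpty using (List⁺) renaming (last to last⁺; _∷_ to _∷⁺_)
open import Data.List.Relation.Unary.All using (All)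
open import Data.List.Relation.Unary.Linked using (Linked)
open import Data.Empty using (⊥)
open import Relation.Nullary using (¬_)
open import Relation.Binary.PropositionalEquality using (_≡_; _≢_; subst; sym; cong)
open import Relation.Binary.Construct.Closure.ReflexiveTransitive using (Star)
open import Relation.Binary.Construct.Closure.Equivalence using (EqClosure)
open import Algebra.Structures using (IsGroup)

record Grp : Set₁ where
  field
    Carrier : Set
    _∙_     : Carrier → Carrier → Carrier
    ε       : Carrier
    _⁻¹     : Carrier → Carrier
    isGroup : IsGroup _≡_ _∙_ ε _⁻¹

record Mono (H G : Grp) : Set where
  private
    module H = Grp H
    module G = Grp G
  field
    f     : H.Carrier → G.Carrier
    f-hom : ∀ x y → f (x H.∙ y) ≡ f x G.∙ f y
    f-inj : ∀ {x y} → f x ≡ f y → x ≡ y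

data Path {V E : Set} (ι τ : E → V) : V → V → Set where
  stay : ∀ {a} → Path ι τ a a
  step : ∀ {a b} (y : E) → ι y ≡ a → Path ι τ (τ y) b → Path ι τ a b

record GraphOfGroups : Set₁ where
  field
    V      : Set
    E      : Set
    ι τ    : E → V
    bar    : E → E
    bar-invol : ∀ y → bar (bar y) ≡ y
    bar-fpf   : ∀ y → bar y ≢ y
    ι-bar  : ∀ y → ι y ≡ τ (bar y)
  field
    connected : ∀ a b → Path ι τ a b
    VG     : V → Grp
    EG     : E → Grp
    EG-bar : ∀ y → EG (bar y) ≡ EG y
    emb    : ∀ y → Mono (EG y) (VG (ι y))

module _ (𝒢 : GraphOfGroups) where
  open GraphOfGroups 𝒢

  up : (y : E) → Grp.Carrier (EG y) → Grp.Carrier (VG (ι y))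
  up y c = Mono.f (emb y) c

  upBar : (y : E) → Grp.Carrier (EG y) → Grp.Carrier (VG (ι (bar y)))
  upBar y c = Mono.f (emb (bar y)) (subst Grp.Carrier (sym (EG-bar y)) c)

  -- the alphabet Δ = E(Y) ⊔ ⨆_a (G_a ∖ {1})
  data Letter : Set where
    edge : E → Letter
    elt  : (a : V) (g : Grp.Carrier (VG a)) .(nz : g ≢ Grp.ε (VG a)) → Letter

  Word : Set
  Word = List Letter

  -- Repr a g r : the word r ∈ Δ* represents g ∈ G_a (1 is the empty word).
  data Repr (a : V) : Grp.Carrier (VG a) → Word → Set where
    repε : Repr a (Grp.ε (VG a)) []
    repg : ∀ g .(nz : g ≢ Grp.ε (VG a)) → Repr a g [ elt a g nz ]

  IsElt : V → Word → Set
  IsElt a r = Σ (Grp.Carrier (VG a)) λ g → Repr a g r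

  data Step : Word → Word → Set where
    mul : ∀ (u v : Word) (a : V) (g h : Grp.Carrier (VG a))
            .(nzg : g ≢ Grp.ε (VG a)) .(nzh : h ≢ Grp.ε (VG a)) (r : Word) →
          Repr a (Grp._∙_ (VG a) g h) r →
          Step (u ++ elt a g nzg ∷ elt a h nzh ∷ v) (u ++ r ++ v)
    red : ∀ (u v : Word) (y : E) (c : Grp.Carrier (EG y)) (r₁ r₂ : Word) →
          Repr (ι (bar y)) (upBar y c) r₁ → Repr (ι y) (up y c) r₂ →
          Step (u ++ edge y ∷ r₁ ++ edge (bar y) ∷ v) (u ++ r₂ ++ v)

  Steps : Word → Word → Set
  Steps = Star Step

  -- equality in F(𝒢): the congruence generated by the defining relations
  _≈F_ : Word → Word → Set
  _≈F_ = EqClosure Step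

  BrittonReduced : Word → Set
  BrittonReduced w = ∀ w' → ¬ Step w w'

  CyclicallyBrittonReduced : Word → Set
  CyclicallyBrittonReduced w = ∀ u u' → w ≡ u ++ u' → BrittonReduced (u' ++ u)

  -- conjugacy in F(𝒢): ∃ x with x⁻¹ represented by x', x w x⁻¹ = ŵ
  Conjugate : Word → Word → Set
  Conjugate w w' = Σ Word λ x → Σ Word λ x' → ((x ++ x') ≈F []) × ((x ++ w ++ x') ≈F w')

  -- Words in Π(𝒢): g₀ y₁ g₁ ⋯ yₙ gₙ is given by g₀ and the list of blocks (yᵢ , gᵢ).
  blocks : List (E × Word) → Word
  blocks = concatMap (λ p → edge (proj₁ p) ∷ proj₂ p)

  piWord : Word → List (E × Word) → Word
  piWord g₀ ps = g₀ ++ blocks ps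

  InΠ : Word → List (E × Word) → Set
  InΠ g₀ [] = ⊥
  InΠ g₀ ((y₁ , g₁) ∷ ps) =
    IsElt (ι y₁) g₀ ×
    All (λ p → IsElt (τ (proj₁ p)) (proj₂ p)) ((y₁ , g₁) ∷ ps) ×
    Linked (λ y y' → τ y ≡ ι y') (map proj₁ ((y₁ , g₁) ∷ ps)) ×
    (τ (last⁺ (y₁ ∷⁺ map proj₁ ps)) ≡ ι y₁)

  rotWord : Word → List (E × Word) → ℕ → Word
  rotWord g₀ ps m = blocks (proj₂ (splitAt m ps)) ++ g₀ ++ blocks (proj₁ (splitAt m ps))

module Submission where

-- Write w = g₀ T D with T = y₁g₁⋯y_m g_m, D = y_{m+1}g_{m+1}⋯yₙgₙ and m = ⌊n/2⌋, so
-- the rotated word is D g₀ T and D has as many edges as T, or one more.  The heart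
-- of the proof is an invariant (`Shape`) of all words reachable from D g₀ T by
-- B_𝒢-steps: such a word is either a word over a single vertex group, or has the form
--   A y M B,   A y = initial part of a walk ending in the edge y,  M a word over G_{τ y},
--   B = the blocks of a walk leaving τ y,  the "seam" B A y irreducible,
-- with B having as many edges as A y, or one fewer.  Since redexes contain no edge
-- in their interior (`redex-locality`), a merge can only happen inside M and a
-- cancellation must remove exactly the edges around M, which preserves the shape.
-- Finally a Britton-reduced word of this shape is cyclically reduced: it is either
-- short (at most one edge and one vertex letter), or every redex of its square would
-- lie in the word itself or in the seam.  Conjugacy holds because a rotation is a
-- conjugation in F(𝒢) and B_𝒢-steps are equalities there.

open import Defs
open import Level using (0ℓ)
open import Data.Nat using (ℕ; zero; suc; _+_; _∸_; _≤_; z≤n; s≤s; s≤s⁻¹; ⌊_/2⌋; ⌈_/2⌉)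
open import Data.Nat.Properties
  using (≤-trans; 1+n≰n; m≤m+n; m≤n+m; +-comm; m≤n⇒m⊓n≡m; m+n∸m≡n; ⌊n/2⌋≤n; ⌊n/2⌋≤⌈n/2⌉; ⌊n/2⌋+⌈n/2⌉≡n)
open import Data.Product using (Σ; ∃; _×_; _,_; proj₁; proj₂)
open import Data.Sum using (_⊎_; inj₁; inj₂)
open import Data.List
  using (List; []; _∷_; _++_; [_]; map; length; take; drop; initLast; _∷ʳ_; _∷ʳ′_)
open import Data.List.Properties
  using (++-assoc; ++-identityʳ; ++-conicalʳ; ∷-injective; ++-monoid; map-++; length-++;
         concatMap-++; take++drop≡id; splitAt-defn; length-take; length-drop)
open import Data.Nat.ListAction using (sum)
open import Data.Nat.ListAction.Properties using (sum-++)
open import Data.List.NonEmpty using () renaming (last to last⁺; _∷_ to _∷⁺_)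
open import Data.List.Relation.Unary.All using (All; []; _∷_)
open import Data.List.Relation.Unary.All.Properties using (++⁺; ++⁻)
open import Data.List.Relation.Unary.Linked using (Linked; [-]; _∷_)
open import Data.Empty using (⊥-elim)
open import Relation.Nullary using (¬_; yes; no)
open import Relation.Nullary.Decidable using (¬¬-excluded-middle)
open import Relation.Binary.PropositionalEquality
  using (_≡_; _≢_; refl; sym; trans; cong; subst; subst₂)
import Relation.Binary.Construct.Closure.ReflexiveTransitive as Star
import Relation.Binary.Construct.Closure.Equivalence as EqClosure
open import Relation.Binary.Construct.Closure.Symmetric using (fwd)
open import Algebra.Bundles using (Group)
import Algebra.Properties.Group as GroupProperties
open import Algebra.Structures using (IsGroup)
import Algebra.Solver.Monoid as MonoidSolver

module _ {A : Set} where

  ++-equidivisible : ∀ (a b c d : List A) → a ++ b ≡ c ++ d →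
    (∃ λ k → c ≡ a ++ k × b ≡ k ++ d) ⊎ (∃ λ k → a ≡ c ++ k × d ≡ k ++ b)
  ++-equidivisible []      b c       d eq = inj₁ (c , refl , eq)
  ++-equidivisible (x ∷ a) b []      d eq = inj₂ (x ∷ a , refl , sym eq)
  ++-equidivisible (x ∷ a) b (z ∷ c) d eq with refl , eq′ ← ∷-injective eq
    with ++-equidivisible a b c d eq′
  ... | inj₁ (k , c≡ , b≡) = inj₁ (k , cong (x ∷_) c≡ , b≡)
  ... | inj₂ (k , a≡ , d≡) = inj₂ (k , cong (x ∷_) a≡ , d≡)

  data Position (u p v X : List A) (x : A) (Y : List A) : Set where
    before : ∀ u′ → u ≡ X ++ x ∷ u′ → Y ≡ u′ ++ p ++ v → Position u p v X x Y
    inside : ∀ k k′ → p ≡ k ++ x ∷ k′ → X ≡ u ++ k → Y ≡ k′ ++ v → Position u p v X x Y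
    after  : ∀ v′ → X ≡ u ++ p ++ v′ → v ≡ v′ ++ x ∷ Y → Position u p v X x Y

  locate : ∀ u p v X x Y → u ++ p ++ v ≡ X ++ x ∷ Y → Position u p v X x Y
  locate u p v X x Y eq
    with ++-equidivisible (u ++ p) v X (x ∷ Y) (trans (++-assoc u p v) eq)
  ... | inj₁ (k , X≡ , v≡) = after k (trans X≡ (++-assoc u p k)) v≡
  ... | inj₂ ([] , up≡ , refl) =
    after [] (trans (sym (++-identityʳ X)) (trans (sym up≡) (cong (u ++_) (sym (++-identityʳ p))))) refl
  ... | inj₂ (_ ∷ k , up≡ , x∷Y≡) with refl , Y≡ ← ∷-injective x∷Y≡
    with ++-equidivisible u p X (x ∷ k) up≡
  ... | inj₁ (j , X≡ , p≡) = inside j k p≡ X≡ Y≡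
  ... | inj₂ ([] , u≡ , p≡) =
    inside [] k (sym p≡) (trans (sym (++-identityʳ X)) (trans (sym u≡) (sym (++-identityʳ u)))) Y≡
  ... | inj₂ (_ ∷ j , u≡ , x∷k≡) with refl , k≡ ← ∷-injective x∷k≡ =
    before j u≡ (trans Y≡ (trans (cong (_++ v) k≡) (++-assoc j p v)))

  last⁺-∷ : ∀ (x y : A) ys → last⁺ (x ∷⁺ y ∷ ys) ≡ last⁺ (y ∷⁺ ys)
  last⁺-∷ x y ys with initLast ys
  ... | []       = refl
  ... | _ ∷ʳ′ _ = refl

  length-∷ʳ : ∀ (xs : List A) x → length (xs ∷ʳ x) ≡ suc (length xs)
  length-∷ʳ xs x = trans (length-++ xs) (+-comm (length xs) 1)

Balanced : ℕ → ℕ → Set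
Balanced l r = l ≤ r × r ≤ suc l

balanced-swap : ∀ {l r} → Balanced l (suc r) → Balanced r l
balanced-swap (l≤1+r , 1+r≤1+l) = s≤s⁻¹ 1+r≤1+l , l≤1+r

⌈n/2⌉≤1+⌊n/2⌋ : ∀ n → ⌈ n /2⌉ ≤ suc ⌊ n /2⌋
⌈n/2⌉≤1+⌊n/2⌋ zero          = z≤n
⌈n/2⌉≤1+⌊n/2⌋ (suc zero)    = s≤s z≤n
⌈n/2⌉≤1+⌊n/2⌋ (suc (suc n)) = s≤s (⌈n/2⌉≤1+⌊n/2⌋ n)

halves-balanced : ∀ {A : Set} (xs : List A) → let m = ⌊ length xs /2⌋ in
  Balanced (length (take m xs)) (length (drop m xs))
halves-balanced xs = subst₂ Balanced (sym |take|) (sym |drop|) (⌊n/2⌋≤⌈n/2⌉ n , ⌈n/2⌉≤1+⌊n/2⌋ n)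
  where
  n : ℕ
  n = length xs
  |take| : length (take ⌊ n /2⌋ xs) ≡ ⌊ n /2⌋
  |take| = trans (length-take ⌊ n /2⌋ xs) (m≤n⇒m⊓n≡m (⌊n/2⌋≤n n))
  |drop| : length (drop ⌊ n /2⌋ xs) ≡ ⌈ n /2⌉
  |drop| = trans (length-drop ⌊ n /2⌋ xs)
                 (trans (cong (_∸ ⌊ n /2⌋) (sym (⌊n/2⌋+⌈n/2⌉≡n n))) (m+n∸m≡n ⌊ n /2⌋ ⌈ n /2⌉))

group : Grp → Group 0ℓ 0ℓ
group G = record
  { Carrier = Carrier ; _≈_ = _≡_ ; _∙_ = _∙_ ; ε = ε ; _⁻¹ = _⁻¹ ; isGroup = isGroup }
  where open Grp G

inverse-nontrivial : (G : Grp) → ∀ {g} → g ≢ Grp.ε G → Grp._⁻¹ G g ≢ Grp.ε G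
inverse-nontrivial G g≢ε g⁻¹≡ε = g≢ε (⁻¹-injective (trans g⁻¹≡ε (sym ε⁻¹≈ε)))
  where open GroupProperties (group G) using (⁻¹-injective; ε⁻¹≈ε)

mono-ε : ∀ {H G} (m : Mono H G) → Mono.f m (Grp.ε H) ≡ Grp.ε G
mono-ε {H} {G} m = identityˡ-unique (f (Grp.ε H)) (f (Grp.ε H))
  (trans (sym (f-hom (Grp.ε H) (Grp.ε H))) (cong f (IsGroup.identityˡ (Grp.isGroup H) (Grp.ε H))))
  where
  open Mono m
  open GroupProperties (group G) using (identityˡ-unique)

subst-ε : ∀ {G H : Grp} (p : H ≡ G) → subst Grp.Carrier (sym p) (Grp.ε G) ≡ Grp.ε H
subst-ε refl = refl

module Theory (𝒢 : GraphOfGroups) where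
  open GraphOfGroups 𝒢
  open MonoidSolver (++-monoid (Letter 𝒢)) using (solve; _⊜_; _⊕_; id)

  data Elt (a : V) : Letter 𝒢 → Set where
    is-elt : ∀ g .(nz : g ≢ Grp.ε (VG a)) → Elt a (elt a g nz)

  Over : V → Word 𝒢 → Set
  Over a = All (Elt a)

  over-no-edge : ∀ {a e} u w → ¬ Over a (u ++ edge e ∷ w)
  over-no-edge []      w (() ∷ _)
  over-no-edge (_ ∷ u) w (_ ∷ o) = over-no-edge u w o

  isElt⇒over : ∀ {a r} → IsElt 𝒢 a r → Over a r
  isElt⇒over (_ , repε)       = []
  isElt⇒over (_ , repg g nz) = is-elt g nz ∷ []

  last-edge : ∀ {a e′ e} M u w → Over a M → M ++ edge e′ ∷ [] ≡ u ++ edge e ∷ w →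
    u ≡ M × e′ ≡ e × w ≡ []
  last-edge []      []            w _        refl = refl , refl , refl
  last-edge []      (_ ∷ [])      w _        ()
  last-edge []      (_ ∷ _ ∷ _)   w _        ()
  last-edge (_ ∷ M) []            w (() ∷ _) refl
  last-edge (m ∷ M) (_ ∷ u)       w (_ ∷ o)  eq with refl , eq′ ← ∷-injective eq
    with refl , e′≡e , w≡[] ← last-edge M u w o eq′ = refl , e′≡e , w≡[]

  data Redex : Word 𝒢 → Word 𝒢 → Set where
    merge  : ∀ a g h .(nzg : g ≢ Grp.ε (VG a)) .(nzh : h ≢ Grp.ε (VG a)) r →
             Repr 𝒢 a (Grp._∙_ (VG a) g h) r → Redex (elt a g nzg ∷ elt a h nzh ∷ []) r
    cancel : ∀ y c r₁ r₂ → Repr 𝒢 (ι (bar y)) (upBar 𝒢 y c) r₁ → Repr 𝒢 (ι y) (up 𝒢 y c) r₂ →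
             Redex (edge y ∷ r₁ ++ edge (bar y) ∷ []) r₂

  data Reducible (x : Word 𝒢) : Set where
    redex-at : ∀ u {p q} v → x ≡ u ++ p ++ v → Redex p q → Reducible x

  redex-step : ∀ {p q} u v → Redex p q → Step 𝒢 (u ++ p ++ v) (u ++ q ++ v)
  redex-step u v (merge a g h nzg nzh r rep) = mul u v a g h nzg nzh r rep
  redex-step u v (cancel y c r₁ r₂ rep₁ rep₂) =
    subst (λ z → Step 𝒢 z (u ++ r₂ ++ v)) (cong (λ z → u ++ edge y ∷ z) (sym (++-assoc r₁ _ v)))
      (red u v y c r₁ r₂ rep₁ rep₂)

  step-redex : ∀ {x x′} → Step 𝒢 x x′ → Σ (Word 𝒢) λ u → Σ (Word 𝒢) λ p → Σ (Word 𝒢) λ q →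
    Σ (Word 𝒢) λ v → x ≡ u ++ p ++ v × x′ ≡ u ++ q ++ v × Redex p q
  step-redex (mul u v a g h nzg nzh r rep) = u , _ , r , v , refl , refl , merge a g h nzg nzh r rep
  step-redex (red u v y c r₁ r₂ rep₁ rep₂) =
    u , _ , r₂ , v , cong (λ z → u ++ edge y ∷ z) (sym (++-assoc r₁ _ v)) , refl ,
    cancel y c r₁ r₂ rep₁ rep₂

  britton⇒irreducible : ∀ {x} → BrittonReduced 𝒢 x → ¬ Reducible x
  britton⇒irreducible reduced (redex-at u v refl ρ) = reduced _ (redex-step u v ρ)

  irreducible⇒britton : ∀ {x} → ¬ Reducible x → BrittonReduced 𝒢 x
  irreducible⇒britton nr _ st with u , _ , _ , v , x≡ , _ , ρ ← step-redex st = nr (redex-at u v x≡ ρ)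

  irreducible-factor : ∀ {z} l x r → z ≡ l ++ x ++ r → ¬ Reducible z → ¬ Reducible x
  irreducible-factor l x r refl nr (redex-at u {p} v refl ρ) =
    nr (redex-at (l ++ u) (v ++ r)
         (solve 5 (λ l u p v r → l ⊕ (u ⊕ p ⊕ v) ⊕ r ⊜ (l ⊕ u) ⊕ p ⊕ v ⊕ r) refl l u p v r) ρ)

  irreducible-prefix : ∀ x y → ¬ Reducible (x ++ y) → ¬ Reducible x
  irreducible-prefix x y = irreducible-factor [] x y refl

  irreducible-suffix : ∀ x y → ¬ Reducible (x ++ y) → ¬ Reducible y
  irreducible-suffix x y = irreducible-factor x y [] (cong (x ++_) (sym (++-identityʳ y)))

  -- Locality of redexes

  redex-boundary : ∀ {p q} → Redex p q → ∀ k {e} k′ → p ≡ k ++ edge e ∷ k′ → k ≡ [] ⊎ k′ ≡ []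
  redex-boundary (merge a g h nzg nzh _ _) k k′ eq =
    ⊥-elim (over-no-edge k k′ (subst (Over a) eq (is-elt g nzg ∷ is-elt h nzh ∷ [])))
  redex-boundary (cancel _ _ _ _ _ _) [] k′ _ = inj₁ refl
  redex-boundary (cancel _ _ r₁ _ rep₁ _) (_ ∷ k) k′ eq =
    inj₂ (proj₂ (proj₂ (last-edge r₁ k k′ (isElt⇒over (_ , rep₁)) (proj₂ (∷-injective eq)))))

  redex-locality : ∀ {p q} → Redex p q → ∀ u v X e Y → u ++ p ++ v ≡ X ++ edge e ∷ Y →
    (∃ λ v₁ → X ++ edge e ∷ [] ≡ u ++ p ++ v₁ × v ≡ v₁ ++ Y) ⊎
    (∃ λ u₁ → u ≡ X ++ u₁ × edge e ∷ Y ≡ u₁ ++ p ++ v)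
  redex-locality {p} ρ u v X e Y eq with locate u p v X (edge e) Y eq
  ... | before u′ refl refl = inj₂ (edge e ∷ u′ , refl , refl)
  ... | after v′ refl refl =
    inj₁ (v′ ++ [ edge e ] ,
          solve 4 (λ u p v′ e → (u ⊕ p ⊕ v′) ⊕ e ⊜ u ⊕ p ⊕ v′ ⊕ e) refl u p v′ [ edge e ] ,
          sym (++-assoc v′ [ edge e ] Y))
  ... | inside k k′ p≡ refl refl with redex-boundary ρ k k′ p≡
  ...   | inj₁ refl =
    inj₂ ([] , sym (trans (++-identityʳ (u ++ [])) (++-identityʳ u)) , cong (_++ v) (sym p≡))
  ...   | inj₂ refl =
    inj₁ ([] , trans (++-assoc u k _) (cong (u ++_) (trans (sym p≡) (sym (++-identityʳ p)))) , refl)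

  count : (Letter 𝒢 → ℕ) → Word 𝒢 → ℕ
  count f w = sum (map f w)

  isEdge isVertexLetter : Letter 𝒢 → ℕ
  isEdge (edge _)          = 1
  isEdge (elt _ _ _)       = 0
  isVertexLetter (edge _)    = 0
  isVertexLetter (elt _ _ _) = 1

  count-++ : ∀ f u v → count f (u ++ v) ≡ count f u + count f v
  count-++ f u v = trans (cong sum (map-++ f u v)) (sum-++ (map f u) (map f v))

  count-factor : ∀ f u p v → count f p ≤ count f (u ++ p ++ v)
  count-factor f u p v =
    subst (count f p ≤_) (sym (trans (count-++ f u (p ++ v)) (cong (count f u +_) (count-++ f p v))))
      (≤-trans (m≤m+n (count f p) (count f v)) (m≤n+m _ (count f u)))

  count-rotate : ∀ f u v → count f (v ++ u) ≡ count f (u ++ v)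
  count-rotate f u v = trans (count-++ f v u) (trans (+-comm (count f v) _) (sym (count-++ f u v)))

  redex-count : ∀ {p q} → Redex p q → 2 ≤ count isEdge p ⊎ 2 ≤ count isVertexLetter p
  redex-count (merge _ _ _ _ _ _ _)  = inj₂ (s≤s (s≤s z≤n))
  redex-count (cancel _ _ r₁ _ _ _) =
    inj₁ (s≤s (subst (1 ≤_) (sym (count-++ isEdge r₁ _)) (m≤n+m 1 (count isEdge r₁))))

  short-irreducible : ∀ x → count isEdge x ≤ 1 → count isVertexLetter x ≤ 1 → ¬ Reducible x
  short-irreducible x ≤1 ≤1′ (redex-at u {p} v refl ρ) with redex-count ρ
  ... | inj₁ 2≤ = 1+n≰n (≤-trans 2≤ (≤-trans (count-factor isEdge u p v) ≤1))
  ... | inj₂ 2≤ = 1+n≰n (≤-trans 2≤ (≤-trans (count-factor isVertexLetter u p v) ≤1′))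

  -- Both counts are invariant under cyclic permutation, so such a word is even
  -- cyclically Britton-reduced.
  short-cyclic : ∀ x → count isEdge x ≤ 1 → count isVertexLetter x ≤ 1 →
    CyclicallyBrittonReduced 𝒢 x
  short-cyclic x ≤1 ≤1′ u v refl = irreducible⇒britton (short-irreducible (v ++ u)
    (subst (_≤ 1) (sym (count-rotate isEdge u v)) ≤1)
    (subst (_≤ 1) (sym (count-rotate isVertexLetter u v)) ≤1′))

  -- Every cyclic permutation of x is a factor of x x.
  square-cyclic : ∀ x → ¬ Reducible (x ++ x) → CyclicallyBrittonReduced 𝒢 x
  square-cyclic x nr u v refl = irreducible⇒britton (irreducible-factor u (v ++ u) v
    (solve 2 (λ u v → (u ⊕ v) ⊕ (u ⊕ v) ⊜ u ⊕ (v ⊕ u) ⊕ v) refl u v) nr)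

  -- If  w = x y M y′ B′  and its seam  y′ B′ x y  are irreducible, then so is w w:
  -- a redex of w w lies inside one of them.
  square-irreducible : ∀ x e M e′ B′ →
    ¬ Reducible (x ++ edge e ∷ M ++ edge e′ ∷ B′) → ¬ Reducible (edge e′ ∷ B′ ++ x ++ [ edge e ]) →
    ¬ Reducible ((x ++ edge e ∷ M ++ edge e′ ∷ B′) ++ (x ++ edge e ∷ M ++ edge e′ ∷ B′))
  square-irreducible x e M e′ B′ nr-w nr-seam (redex-at u v eq ρ)
    with redex-locality ρ u v ((x ++ edge e ∷ M ++ edge e′ ∷ B′) ++ x) e (M ++ edge e′ ∷ B′)
           (trans (sym eq) (sym (++-assoc (x ++ edge e ∷ M ++ edge e′ ∷ B′) x _)))
  ... | inj₂ (u₁ , _ , eq₂) = irreducible-suffix x _ nr-w (redex-at u₁ v eq₂ ρ)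
  ... | inj₁ (v₁ , eq₁ , _)
    with redex-locality ρ u v₁ (x ++ edge e ∷ M) e′ (B′ ++ x ++ [ edge e ])
           (trans (sym eq₁) (solve 5 (λ x E M E′ B′ → ((x ⊕ (E ⊕ (M ⊕ (E′ ⊕ B′)))) ⊕ x) ⊕ E
                                      ⊜ (x ⊕ (E ⊕ M)) ⊕ (E′ ⊕ (B′ ⊕ (x ⊕ E))))
                                     refl x [ edge e ] M [ edge e′ ] B′))
  ...   | inj₂ (u₂ , _ , eq₂) = nr-seam (redex-at u₂ v₁ eq₂ ρ)
  ...   | inj₁ (v₂ , eq₂ , _) =
    irreducible-factor [] _ B′ (solve 5 (λ x E M E′ B′ → x ⊕ (E ⊕ (M ⊕ (E′ ⊕ B′)))
                                          ⊜ id ⊕ ((x ⊕ (E ⊕ M)) ⊕ E′) ⊕ B′)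
                                  refl x [ edge e ] M [ edge e′ ] B′)
      nr-w (redex-at u v₂ eq₂ ρ)

  -- Two adjacent letters of the same vertex group form a merge redex (the product
  -- is trivial or not; we only need this under a double negation).
  adjacent-reducible : ∀ {a l₁ l₂} → Elt a l₁ → Elt a l₂ → ∀ X Y → ¬ ¬ Reducible (X ++ l₁ ∷ l₂ ∷ Y)
  adjacent-reducible {a} (is-elt g nzg) (is-elt h nzh) X Y nr = ¬¬-excluded-middle λ
    { (yes gh≡ε) → nr (redex-at X Y refl
        (merge a g h nzg nzh [] (subst (λ z → Repr 𝒢 a z []) (sym gh≡ε) repε)))
    ; (no gh≢ε) → nr (redex-at X Y refl (merge a g h nzg nzh _ (repg _ gh≢ε))) }

  over-irreducible : ∀ {a} M → Over a M → ¬ Reducible M →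
    count isEdge M ≡ 0 × count isVertexLetter M ≤ 1
  over-irreducible []          _                 _  = refl , z≤n
  over-irreducible (_ ∷ [])    (is-elt _ _ ∷ []) _  = refl , s≤s z≤n
  over-irreducible (_ ∷ _ ∷ M) (o₁ ∷ o₂ ∷ _)     nr = ⊥-elim (adjacent-reducible o₁ o₂ [] M nr)

  data Walk : V → List (E × Word 𝒢) → V → Set where
    []   : ∀ {a} → Walk a [] a
    cons : ∀ {a b g ps} y → ι y ≡ a → IsElt 𝒢 (τ y) g → Walk (τ y) ps b → Walk a ((y , g) ∷ ps) b

  walk-++⁻ : ∀ T {D a b} → Walk a (T ++ D) b → ∃ λ c → Walk a T c × Walk c D b
  walk-++⁻ []      w              = _ , [] , w
  walk-++⁻ (_ ∷ T) (cons y p e w) with c , w₁ , w₂ ← walk-++⁻ T w = c , cons y p e w₁ , w₂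

  walk-∷ʳ⁻ : ∀ L {y g a b} → Walk a (L ∷ʳ (y , g)) b → Walk a L (ι y) × IsElt 𝒢 (τ y) g × τ y ≡ b
  walk-∷ʳ⁻ []      (cons y refl e []) = [] , e , refl
  walk-∷ʳ⁻ (_ ∷ L) (cons y p e w) with w′ , e′ , q ← walk-∷ʳ⁻ L w = cons y p e w′ , e′ , q

  blocks-∷ʳ : ∀ L y g → blocks 𝒢 (L ∷ʳ (y , g)) ≡ blocks 𝒢 L ++ edge y ∷ g
  blocks-∷ʳ L y g = trans (concatMap-++ _ L _) (cong (λ z → blocks 𝒢 L ++ edge y ∷ z) (++-identityʳ g))

  linked-walk : ∀ {a} y g ps → ι y ≡ a → All (λ p → IsElt 𝒢 (τ (proj₁ p)) (proj₂ p)) ((y , g) ∷ ps) →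
    Linked (λ y y′ → τ y ≡ ι y′) (y ∷ map proj₁ ps) →
    Walk a ((y , g) ∷ ps) (τ (last⁺ (y ∷⁺ map proj₁ ps)))
  linked-walk y g []               p (e ∷ [])  [-]          = cons y p e []
  linked-walk y g ((y′ , g′) ∷ ps) p (e ∷ es) (τy≡ιy′ ∷ lk) =
    cons y p e (subst (Walk _ _) (cong τ (sym (last⁺-∷ y y′ (map proj₁ ps))))
                  (linked-walk y′ g′ ps (sym τy≡ιy′) es lk))

  inΠ-walk : ∀ g₀ ps → InΠ 𝒢 g₀ ps → ∃ λ a → IsElt 𝒢 a g₀ × Walk a ps a
  inΠ-walk g₀ ((y₁ , g₁) ∷ ps) (e₀ , es , lk , closed) =
    ι y₁ , e₀ , subst (Walk _ _) closed (linked-walk y₁ g₁ ps refl es lk)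

  -- The invariant

  data Shape : Word 𝒢 → Set where
    flat    : ∀ {a M} → Over a M → Shape M
    layered : ∀ {c d M} L y R → Walk c L (ι y) → Over (τ y) M → Walk (τ y) R d →
              ¬ Reducible (blocks 𝒢 R ++ blocks 𝒢 L ++ [ edge y ]) →
              Balanced (length L) (length R) → Shape (blocks 𝒢 L ++ edge y ∷ M ++ blocks 𝒢 R)

  over-merge : ∀ {a b g h r} .{nzg nzh} u v → Over b (u ++ elt a g nzg ∷ elt a h nzh ∷ v) →
    Repr 𝒢 a (Grp._∙_ (VG a) g h) r → Over b (u ++ r ++ v)
  over-merge u v o rep with ou , is-elt _ _ ∷ _ ∷ ov ← ++⁻ u o =
    ++⁺ ou (++⁺ (isElt⇒over (_ , rep)) ov)

  edge-free-in-prefix : ∀ {b p q} M R u v → Over b p → Redex p q → ¬ Reducible (blocks 𝒢 R) →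
    M ++ blocks 𝒢 R ≡ u ++ p ++ v → ∃ λ v′ → M ≡ u ++ p ++ v′ × v ≡ v′ ++ blocks 𝒢 R
  edge-free-in-prefix M [] u v _ _ _ eq = v , trans (sym (++-identityʳ M)) eq , sym (++-identityʳ v)
  edge-free-in-prefix {p = p} M ((y , g) ∷ R) u v o ρ nr eq with locate u p v M (edge y) _ (sym eq)
  ... | before u′ _ eq′       = ⊥-elim (nr (redex-at (edge y ∷ u′) v (cong (edge y ∷_) eq′) ρ))
  ... | inside k k′ p≡ _ _    = ⊥-elim (over-no-edge k k′ (subst (Over _) p≡ o))
  ... | after v′ M≡ v≡        = v′ , M≡ , v≡

  one-edge : ∀ {a y z z′} M m u v → Over a M → ¬ (edge y ∷ M ≡ u ++ (edge z ∷ m ++ edge z′ ∷ []) ++ v)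
  one-edge M m []      v o eq =
    over-no-edge m v (subst (Over _) (trans (proj₂ (∷-injective eq)) (++-assoc m _ v)) o)
  one-edge M m (_ ∷ u) v o eq = over-no-edge u _ (subst (Over _) (proj₂ (∷-injective eq)) o)

  window : ∀ {a y y′ z z′} M m u v → Over a M →
    (edge y ∷ M) ++ edge y′ ∷ [] ≡ u ++ (edge z ∷ m ++ edge z′ ∷ []) ++ v →
    u ≡ [] × y ≡ z × M ≡ m × y′ ≡ z′ × v ≡ []
  window M m [] v o eq with refl , eq′ ← ∷-injective eq
    with refl , refl , refl ← last-edge M m v o (trans eq′ (++-assoc m _ v)) =
    refl , refl , refl , refl , refl
  window M m (_ ∷ u) v o eq with _ , _ , rest≡[] ← last-edge M u _ o (proj₂ (∷-injective eq))
    with () ← ++-conicalʳ m _ (trans (sym (++-assoc m _ v)) rest≡[])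

  cancel-at-seam : ∀ {a y z r₁ r₂} M R → Over a M → ¬ Reducible (blocks 𝒢 R) →
    Redex (edge z ∷ r₁ ++ edge (bar z) ∷ []) r₂ → ∀ u v →
    edge y ∷ M ++ blocks 𝒢 R ≡ u ++ (edge z ∷ r₁ ++ edge (bar z) ∷ []) ++ v →
    ∃ λ g′ → ∃ λ R′ → R ≡ (bar z , g′) ∷ R′ × u ≡ [] × y ≡ z × M ≡ r₁ × v ≡ g′ ++ blocks 𝒢 R′
  cancel-at-seam M [] o _ _ u v eq = ⊥-elim (one-edge (M ++ []) _ u v (++⁺ o []) eq)
  cancel-at-seam M ((y′ , g′) ∷ R′) o nr ρ u v eq
    with redex-locality ρ u v (edge _ ∷ M) y′ (g′ ++ blocks 𝒢 R′) (sym eq)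
  ... | inj₂ (u₂ , _ , eq₂) = ⊥-elim (nr (redex-at u₂ v eq₂ ρ))
  ... | inj₁ (v₁ , eq₁ , v≡) with refl , refl , refl , refl , refl ← window M _ u v₁ o eq₁ =
    g′ , R′ , refl , refl , refl , refl , v≡

  -- After cancelling  y M ȳ  in  A y M ȳ g′ B′, the word has a shape again: if A is
  -- empty then so is B′ and the word lies in G_{ι y}; otherwise the last block of A
  -- and the first of B are used up.
  shape-after-cancel : ∀ {c d y g′ r₂} L R′ → Walk c L (ι y) → Walk (τ (bar y)) R′ d →
    IsElt 𝒢 (τ (bar y)) g′ → IsElt 𝒢 (ι y) r₂ →
    ¬ Reducible (blocks 𝒢 ((bar y , g′) ∷ R′) ++ blocks 𝒢 L ++ [ edge y ]) →
    Balanced (length L) (suc (length R′)) →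
    Shape ((blocks 𝒢 L ++ []) ++ r₂ ++ g′ ++ blocks 𝒢 R′)
  shape-after-cancel L R′ wL wR e′ e₂ seam bal with initLast L
  shape-after-cancel {y = y} .[] [] wL wR e′ e₂ seam bal | [] =
    flat (++⁺ (isElt⇒over e₂) (++⁺ (subst (λ a → Over a _) (sym (ι-bar y)) (isElt⇒over e′)) []))
  shape-after-cancel .[] (_ ∷ _) wL wR e′ e₂ seam (_ , s≤s ()) | []
  shape-after-cancel {y = y} {g′} {r₂} .(L ∷ʳ (yL , gL)) R′ wL wR e′ e₂ seam bal | L ∷ʳ′ (yL , gL)
    with wL′ , eL , τyL≡ιy ← walk-∷ʳ⁻ L wL
    rewrite blocks-∷ʳ L yL gL =
    subst Shape shape≡ (layered L yL R′ wL′ overM wR′ seam′ bal′)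
    where
    ιy≡τyL : ι y ≡ τ yL
    ιy≡τyL = sym τyL≡ιy
    overM : Over (τ yL) (gL ++ r₂ ++ g′)
    overM = ++⁺ (isElt⇒over eL) (subst (λ a → Over a (r₂ ++ g′)) ιy≡τyL
              (++⁺ (isElt⇒over e₂) (subst (λ a → Over a g′) (sym (ι-bar y)) (isElt⇒over e′))))
    wR′ : Walk (τ yL) R′ _
    wR′ = subst (λ a → Walk a R′ _) (trans (sym (ι-bar y)) ιy≡τyL) wR
    seam′ : ¬ Reducible (blocks 𝒢 R′ ++ blocks 𝒢 L ++ [ edge yL ])
    seam′ = irreducible-factor (edge (bar y) ∷ g′) _ (gL ++ [ edge y ])
      (solve 7 (λ Ȳ g′ R′ L YL gL Y → (Ȳ ⊕ g′ ⊕ R′) ⊕ ((L ⊕ YL ⊕ gL) ⊕ Y)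
                                       ⊜ (Ȳ ⊕ g′) ⊕ (R′ ⊕ L ⊕ YL) ⊕ (gL ⊕ Y))
         refl [ edge (bar y) ] g′ (blocks 𝒢 R′) (blocks 𝒢 L) [ edge yL ] gL [ edge y ]) seam
    bal′ : Balanced (length L) (length R′)
    bal′ = balanced-swap (balanced-swap (subst (λ l → Balanced l _) (length-∷ʳ L _) bal))
    shape≡ : blocks 𝒢 L ++ edge yL ∷ (gL ++ r₂ ++ g′) ++ blocks 𝒢 R′
           ≡ ((blocks 𝒢 L ++ edge yL ∷ gL) ++ []) ++ r₂ ++ g′ ++ blocks 𝒢 R′
    shape≡ = solve 6 (λ L YL gL r₂ g′ R′ → L ⊕ YL ⊕ (gL ⊕ r₂ ⊕ g′) ⊕ R′
                                          ⊜ ((L ⊕ YL ⊕ gL) ⊕ id) ⊕ r₂ ⊕ g′ ⊕ R′)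
               refl (blocks 𝒢 L) [ edge yL ] gL r₂ g′ (blocks 𝒢 R′)

  -- Rewriting one redex preserves the shape: a merge happens inside the vertex-group
  -- part, a cancellation removes the two edges around it.
  shape-redex : ∀ {x p q} → Shape x → Redex p q → ∀ u v → x ≡ u ++ p ++ v → Shape (u ++ q ++ v)
  shape-redex (flat o) (merge _ _ _ _ _ _ rep) u v eq = flat (over-merge u v (subst (Over _) eq o) rep)
  shape-redex (flat o) (cancel _ _ _ _ _ _) u v eq = ⊥-elim (over-no-edge u _ (subst (Over _) eq o))
  shape-redex (layered {M = M} L y R wL oM wR seam bal) ρ@(merge a g h nzg nzh r rep) u v eq
    with locate u _ v (blocks 𝒢 L) (edge y) (M ++ blocks 𝒢 R) (sym eq)
  ... | after v′ L≡ _ =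
    ⊥-elim (irreducible-prefix _ _ (irreducible-suffix (blocks 𝒢 R) _ seam) (redex-at u v′ L≡ ρ))
  ... | inside k k′ p≡ _ _ =
    ⊥-elim (over-no-edge k k′ (subst (Over a) p≡ (is-elt g nzg ∷ is-elt h nzh ∷ [])))
  ... | before u′ refl M++B≡
    with v′ , refl , refl ← edge-free-in-prefix M R u′ v (is-elt g nzg ∷ is-elt h nzh ∷ []) ρ
                              (irreducible-prefix _ _ seam) M++B≡ =
    subst Shape (solve 6 (λ L Y u′ r v′ R → L ⊕ Y ⊕ (u′ ⊕ r ⊕ v′) ⊕ R ⊜ (L ⊕ Y ⊕ u′) ⊕ r ⊕ v′ ⊕ R)
                         refl (blocks 𝒢 L) [ edge y ] u′ r v′ (blocks 𝒢 R))
      (layered L y R wL (over-merge u′ v′ oM rep) wR seam bal)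
  shape-redex (layered {M = M} L y R wL oM wR seam bal) ρ@(cancel _ _ _ _ _ rep₂) u v eq
    with redex-locality ρ u v (blocks 𝒢 L) y (M ++ blocks 𝒢 R) (sym eq)
  ... | inj₁ (v₁ , eq₁ , _) = ⊥-elim (irreducible-suffix (blocks 𝒢 R) _ seam (redex-at u v₁ eq₁ ρ))
  ... | inj₂ (u₁ , refl , eq₂)
    with g′ , R′ , refl , refl , refl , refl , refl
           ← cancel-at-seam M R oM (irreducible-prefix _ _ seam) ρ u₁ v eq₂
    with cons _ _ e′ wR′ ← wR =
    shape-after-cancel L R′ wL wR′ e′ (_ , rep₂) seam bal

  shape-steps : ∀ {x x′} → Shape x → Steps 𝒢 x x′ → Shape x′
  shape-steps s Star.ε          = s
  shape-steps s (st Star.◅ steps)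
    with u , _ , _ , v , refl , refl , ρ ← step-redex st = shape-steps (shape-redex s ρ u v refl) steps

  -- A Britton-reduced word with a shape is cyclically Britton-reduced: if B is empty it is
  -- short, otherwise its square is irreducible.
  shape-cyclic : ∀ {x} → Shape x → BrittonReduced 𝒢 x → CyclicallyBrittonReduced 𝒢 x
  shape-cyclic (flat {M = M} o) reduced
    with no-edge , ≤1 ← over-irreducible M o (britton⇒irreducible reduced) =
    short-cyclic M (subst (_≤ 1) (sym no-edge) z≤n) ≤1
  shape-cyclic (layered {M = M} [] y [] _ oM _ _ _) reduced
    with no-edge , ≤1 ← over-irreducible (M ++ []) (++⁺ oM [])
                          (irreducible-suffix [ edge y ] _ (britton⇒irreducible reduced)) =
    short-cyclic (edge y ∷ M ++ []) (s≤s (subst (_≤ 0) (sym no-edge) z≤n)) ≤1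
  shape-cyclic (layered (_ ∷ _) _ [] _ _ _ _ (() , _)) _
  shape-cyclic (layered {M = M} L y ((y′ , g′) ∷ R′) _ _ _ seam _) reduced =
    square-cyclic _ (square-irreducible (blocks 𝒢 L) y M y′ (g′ ++ blocks 𝒢 R′)
                                        (britton⇒irreducible reduced) seam)

  rotation-shape : ∀ {a c} g₀ T D → IsElt 𝒢 a g₀ → Walk a T c → Walk c D a →
    ¬ Reducible ((g₀ ++ blocks 𝒢 T) ++ blocks 𝒢 D) → Balanced (length T) (length D) →
    Shape (blocks 𝒢 D ++ g₀ ++ blocks 𝒢 T)
  rotation-shape g₀ T D e₀ wT wD nr bal with initLast D
  rotation-shape g₀ []      .[] e₀ wT wD nr bal | [] = flat (++⁺ (isElt⇒over e₀) [])
  rotation-shape g₀ (_ ∷ _) .[] e₀ wT wD nr (() , _) | []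
  rotation-shape g₀ T .(D ∷ʳ (y , g)) e₀ wT wD nr bal | D ∷ʳ′ (y , g)
    with wD′ , e , τy≡a ← walk-∷ʳ⁻ D wD
    rewrite blocks-∷ʳ D y g =
    subst Shape shape≡ (layered D y T wD′ overM wT′ seam bal′)
    where
    overM : Over (τ y) (g ++ g₀)
    overM = ++⁺ (isElt⇒over e) (subst (λ b → Over b g₀) (sym τy≡a) (isElt⇒over e₀))
    wT′ : Walk (τ y) T _
    wT′ = subst (λ b → Walk b T _) (sym τy≡a) wT
    seam : ¬ Reducible (blocks 𝒢 T ++ blocks 𝒢 D ++ [ edge y ])
    seam = irreducible-factor g₀ _ g
      (solve 5 (λ g₀ T D Y g → (g₀ ⊕ T) ⊕ (D ⊕ Y ⊕ g) ⊜ g₀ ⊕ (T ⊕ D ⊕ Y) ⊕ g)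
         refl g₀ (blocks 𝒢 T) (blocks 𝒢 D) [ edge y ] g) nr
    bal′ : Balanced (length D) (length T)
    bal′ = balanced-swap (subst (Balanced _) (length-∷ʳ D _) bal)
    shape≡ : blocks 𝒢 D ++ edge y ∷ (g ++ g₀) ++ blocks 𝒢 T
           ≡ (blocks 𝒢 D ++ edge y ∷ g) ++ g₀ ++ blocks 𝒢 T
    shape≡ = solve 5 (λ D Y g g₀ T → D ⊕ Y ⊕ (g ⊕ g₀) ⊕ T ⊜ (D ⊕ Y ⊕ g) ⊕ g₀ ⊕ T)
               refl (blocks 𝒢 D) [ edge y ] g g₀ (blocks 𝒢 T)

  -- Conjugacy in F(𝒢)

  infix 4 _≈_
  _≈_ : Word 𝒢 → Word 𝒢 → Set
  _≈_ = _≈F_ 𝒢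

  ≡⇒≈ : ∀ {x y} → x ≡ y → x ≈ y
  ≡⇒≈ refl = Star.ε

  step-context : ∀ {x y} l r → Step 𝒢 x y → Step 𝒢 (l ++ x ++ r) (l ++ y ++ r)
  step-context l r st with u , p , q , v , refl , refl , ρ ← step-redex st =
    subst₂ (Step 𝒢) (reassoc p) (reassoc q) (redex-step (l ++ u) (v ++ r) ρ)
    where
    reassoc : ∀ p → (l ++ u) ++ p ++ v ++ r ≡ l ++ (u ++ p ++ v) ++ r
    reassoc p = solve 5 (λ l u p v r → (l ⊕ u) ⊕ p ⊕ v ⊕ r ⊜ l ⊕ (u ⊕ p ⊕ v) ⊕ r) refl l u p v r

  ≈-context : ∀ {x y} l r → x ≈ y → l ++ x ++ r ≈ l ++ y ++ r
  ≈-context l r = EqClosure.gmap (λ z → l ++ z ++ r) (step-context l r)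

  letter-inverse : Letter 𝒢 → Letter 𝒢
  letter-inverse (edge y)     = edge (bar y)
  letter-inverse (elt a g nz) = elt a (Grp._⁻¹ (VG a) g) (inverse-nontrivial (VG a) nz)

  letter-cancel : ∀ l → l ∷ letter-inverse l ∷ [] ≈ []
  letter-cancel (edge y) = EqClosure.return (red [] [] y (Grp.ε (EG y)) [] []
    (subst (λ z → Repr 𝒢 (ι (bar y)) z []) (sym upBar-ε) repε)
    (subst (λ z → Repr 𝒢 (ι y) z []) (sym (mono-ε (emb y))) repε))
    where
    upBar-ε : upBar 𝒢 y (Grp.ε (EG y)) ≡ Grp.ε (VG (ι (bar y)))
    upBar-ε = trans (cong (Mono.f (emb (bar y))) (subst-ε (EG-bar y))) (mono-ε (emb (bar y)))
  letter-cancel (elt a g nz) = EqClosure.return (mul [] [] a g _ nz _ []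
    (subst (λ z → Repr 𝒢 a z []) (sym (IsGroup.inverseʳ (Grp.isGroup (VG a)) g)) repε))

  inverse : Word 𝒢 → Word 𝒢
  inverse []      = []
  inverse (l ∷ w) = inverse w ++ [ letter-inverse l ]

  inverse-cancel : ∀ w → w ++ inverse w ≈ []
  inverse-cancel []      = Star.ε
  inverse-cancel (l ∷ w) =
    ≡⇒≈ (cong (l ∷_) (sym (++-assoc w (inverse w) _)))
    Star.◅◅ ≈-context [ l ] [ letter-inverse l ] (inverse-cancel w)
    Star.◅◅ letter-cancel l

  rotation-conjugate : ∀ u v → Conjugate 𝒢 (u ++ v) (v ++ u)
  rotation-conjugate u v = v , inverse v , inverse-cancel v ,
    (≡⇒≈ (solve 3 (λ u v v⁻ → v ⊕ (u ⊕ v) ⊕ v⁻ ⊜ (v ⊕ u) ⊕ (v ⊕ v⁻) ⊕ id) refl u v (inverse v))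
     Star.◅◅ ≈-context (v ++ u) [] (inverse-cancel v)
     Star.◅◅ ≡⇒≈ (++-identityʳ (v ++ u)))

  conjugate-steps : ∀ {w z ẑ} → Conjugate 𝒢 w z → Steps 𝒢 z ẑ → Conjugate 𝒢 w ẑ
  conjugate-steps (x , x′ , x-inverse , conj) steps =
    x , x′ , x-inverse , conj Star.◅◅ Star.map fwd steps

  piWord-split : ∀ g₀ ps m → piWord 𝒢 g₀ ps ≡ (g₀ ++ blocks 𝒢 (take m ps)) ++ blocks 𝒢 (drop m ps)
  piWord-split g₀ ps m =
    trans (cong (λ ps → g₀ ++ blocks 𝒢 ps) (sym (take++drop≡id m ps)))
          (trans (cong (g₀ ++_) (concatMap-++ _ (take m ps) (drop m ps))) (sym (++-assoc g₀ _ _)))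

  rotWord-split : ∀ g₀ ps m → rotWord 𝒢 g₀ ps m ≡ blocks 𝒢 (drop m ps) ++ g₀ ++ blocks 𝒢 (take m ps)
  rotWord-split g₀ ps m = cong (λ (T , D) → blocks 𝒢 D ++ g₀ ++ blocks 𝒢 T) (splitAt-defn m ps)

  rotWord-conjugate : ∀ g₀ ps m → Conjugate 𝒢 (piWord 𝒢 g₀ ps) (rotWord 𝒢 g₀ ps m)
  rotWord-conjugate g₀ ps m =
    subst₂ (Conjugate 𝒢) (sym (piWord-split g₀ ps m)) (sym (rotWord-split g₀ ps m))
      (rotation-conjugate (g₀ ++ blocks 𝒢 (take m ps)) (blocks 𝒢 (drop m ps)))

  rotWord-shape : ∀ g₀ ps m → InΠ 𝒢 g₀ ps → ¬ Reducible (piWord 𝒢 g₀ ps) →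
    Balanced (length (take m ps)) (length (drop m ps)) → Shape (rotWord 𝒢 g₀ ps m)
  rotWord-shape g₀ ps m inΠ nr bal with a , e₀ , walk ← inΠ-walk g₀ ps inΠ
    with _ , wT , wD ← walk-++⁻ (take m ps)
                         (subst (λ ps → Walk a ps a) (sym (take++drop≡id m ps)) walk) =
    subst Shape (sym (rotWord-split g₀ ps m))
      (rotation-shape g₀ _ _ e₀ wT wD (subst (λ w → ¬ Reducible w) (piWord-split g₀ ps m) nr) bal)

-- The main theorem: the rotation at ⌊n/2⌋ has a shape, which B_𝒢-steps preserve and which
-- makes a Britton-reduced word cyclically reduced; and it is a conjugate of w.

mainTheorem13 : (𝒢 : GraphOfGroups) → let open GraphOfGroups 𝒢 in
    (g₀ : Word 𝒢) (ps : List (E × Word 𝒢)) → 1 ≤ length ps → InΠ 𝒢 g₀ ps →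
    BrittonReduced 𝒢 (piWord 𝒢 g₀ ps) →
    (ŵ : Word 𝒢) → Steps 𝒢 (rotWord 𝒢 g₀ ps ⌊ length ps /2⌋) ŵ → BrittonReduced 𝒢 ŵ →
    CyclicallyBrittonReduced 𝒢 ŵ × Conjugate 𝒢 (piWord 𝒢 g₀ ps) ŵ
mainTheorem13 𝒢 g₀ ps _ inΠ w-reduced ŵ rotation→ŵ ŵ-reduced =
  shape-cyclic (shape-steps start rotation→ŵ) ŵ-reduced ,
  conjugate-steps (rotWord-conjugate g₀ ps ⌊ length ps /2⌋) rotation→ŵ
  where
  open Theory 𝒢
  start : Shape (rotWord 𝒢 g₀ ps ⌊ length ps /2⌋)
  start = rotWord-shape g₀ ps ⌊ length ps /2⌋ inΠ (britton⇒irreducible w-reduced) (halves-balanced ps)
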